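{- Let $R$ be a finite local commutative ring with unity $e$ and of characteristic $p^{\alpha}$ for a prime $p$, whose elements are encoded by binary strings of length $m$. Let $g\in R[x_1,\ldots,x_n]$ be a polynomial of degree at most $d$ and let $\epsilon>0$. Let $M>2^{m+1}/\epsilon$ and $U=\{ce : 0\le c\le M\}$, where $ce$ denotes the $c$-fold sum $e+\cdots+e$, elements being sampled by choosing $c$ uniformly. If $g\not\equiv 0$, then \[\Pr_{a_1,\ldots,a_n\in U}[g(a_1,\ldots,a_n)=0]\le \frac{nd}{p}\left(1+\frac{\epsilon}{2}\right).\]
   Context: A local ring is a commutative ring with unity that has a unique maximal ideal.
   Formalization: The parameter ε ranges over the positive rationals. -}

module Defs where

open import Level using (Level; _⊔_)
open import Algebra.Bundles using (CommutativeRing)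
open import Data.Nat as ℕ using (ℕ; zero; suc; _<_)
open import Data.Nat.Properties using (m^n≢0)
open import Data.Bool using (Bool)
import Data.Bool.Properties as BoolP
open import Data.Vec as Vec using (Vec; []; _∷_)
open import Data.Vec.Properties using (≡-dec)
open import Data.List as List using (List; [_]; upTo; concatMap; filter; length; foldr)
open import Data.Product using (Σ; ∃; _×_; _,_)
open import Data.Sum using (_⊎_)
open import Data.Integer using (+_)
open import Data.Rational using (ℚ; _/_)
open import Relation.Nullary using (¬_; Dec)
open import Relation.Binary.PropositionalEquality using (_≡_)

allVecs : (n b : ℕ) → List (Vec ℕ n)
allVecs zero    b = [ [] ]
allVecs (suc n) b = concatMap (λ v → List.map (_∷ v) (upTo (suc b))) (allVecs n b)

totalDeg : ∀ {n} → Vec ℕ n → ℕ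
totalDeg = Vec.sum

module _ {c ℓ : Level} (R : CommutativeRing c ℓ) where
  open CommutativeRing R

  _·e : ℕ → Carrier
  zero  ·e = 0#
  suc k ·e = 1# + (k ·e)

  pow : Carrier → ℕ → Carrier
  pow x zero    = 1#
  pow x (suc k) = x * pow x k

  record IsIdeal (I : Carrier → Set (c ⊔ ℓ)) : Set (c ⊔ ℓ) where
    field
      resp     : ∀ {x y} → x ≈ y → I x → I y
      zero∈    : I 0#
      +-closed : ∀ {x y} → I x → I y → I (x + y)
      neg-closed : ∀ {x} → I x → I (- x)
      *-closed : ∀ r {x} → I x → I (r * x)

  IsProperIdeal : (Carrier → Set (c ⊔ ℓ)) → Set (c ⊔ ℓ)
  IsProperIdeal I = IsIdeal I × ∃ λ x → ¬ I x

  IsMaximalIdeal : (Carrier → Set (c ⊔ ℓ)) → Set (Level.suc (c ⊔ ℓ))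
  IsMaximalIdeal I = IsProperIdeal I ×
    (∀ J → IsIdeal J → (∀ x → I x → J x) → (∀ x → J x → I x) ⊎ (∀ x → J x))

  IsLocal : Set (Level.suc (c ⊔ ℓ))
  IsLocal = ∃ λ 𝔪 → IsMaximalIdeal 𝔪 ×
    (∀ 𝔫 → IsMaximalIdeal 𝔫 → ∀ x → (𝔪 x → 𝔫 x) × (𝔫 x → 𝔪 x))

  HasCharacteristic : ℕ → Set ℓ
  HasCharacteristic k = (0 < k) × ((k ·e) ≈ 0#) × (∀ j → 0 < j → j < k → ¬ ((j ·e) ≈ 0#))

  record Encoding (m : ℕ) : Set (c ⊔ ℓ) where
    field
      enc       : Carrier → Vec Bool m
      enc-sound : ∀ {x y} → x ≈ y → enc x ≡ enc y
      enc-inj   : ∀ {x y} → enc x ≡ enc y → x ≈ y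

  -- Polynomials in n variables: coefficient of each monomial x^e (e an exponent vector).
  Poly : ℕ → Set c
  Poly n = Vec ℕ n → Carrier

  DegreeAtMost : ∀ {n} → ℕ → Poly n → Set ℓ
  DegreeAtMost d g = ∀ e → d < totalDeg e → g e ≈ 0#

  NonZeroPoly : ∀ {n} → Poly n → Set ℓ
  NonZeroPoly g = ∃ λ e → ¬ (g e ≈ 0#)

  monomial : ∀ {n} → Vec ℕ n → Vec Carrier n → Carrier
  monomial []       []       = 1#
  monomial (k ∷ ks) (a ∷ as) = pow a k * monomial ks as

  -- Evaluation of a polynomial of degree ≤ d (all monomials of degree ≤ d
  -- have all exponents ≤ d, so summing over {0..d}^n covers the support).
  eval : ∀ {n} → ℕ → Poly n → Vec Carrier n → Carrier
  eval {n} d g a = foldr _+_ 0# (List.map (λ e → g e * monomial e a) (allVecs n d))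

  module _ {m : ℕ} (E : Encoding m) where
    open Encoding E

    isZero? : (x : Carrier) → Dec (enc x ≡ enc 0#)
    isZero? x = ≡-dec BoolP._≟_ (enc x) (enc 0#)

    zeroCount : ∀ {n} → ℕ → Poly n → ℕ → ℕ
    zeroCount {n} d g M =
      length (filter (λ cs → isZero? (eval d g (Vec.map _·e cs))) (allVecs n M))

    zeroProbability : ∀ {n} → ℕ → Poly n → ℕ → ℚ
    zeroProbability {n} d g M =
      (+ zeroCount d g M / (suc M ℕ.^ n)) {{m^n≢0 (suc M) n}}

-- Induction on the number of variables: write g = Σ_j x₁^j g_j and take j from a nonzero coefficient of g.
-- At a point v of the other variables either g_j(v) = 0, and then all M + 1 values of x₁ may be roots, or
-- not, and then the roots c·e of g(x₁, v) lie in at most d residue classes mod p. For the latter, multiply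
-- the coefficient list by the largest power p^k·e that does not kill it: the coefficients become p-torsion,
-- so evaluation at c·e only sees c mod p, and a root at residue r splits off the factor x − r·e, every root
-- of another residue being a root of the quotient because residues that differ mod p differ by a unit.
-- A residue class meets {0, …, M} in at most (M + 1 + p)/p points, which gives
-- Pr ≤ n d (M + 1 + p) / (p (M + 1)). Finally p ≤ 2^m, as 0, e, …, (p − 1)e are distinct elements of R,
-- so p / (M + 1) < ε / 2 by the choice of M.

module Submission where

open import Defs
open import Algebra.Bundles using (CommutativeRing)

module Counting where

  open import Data.Nat using (ℕ; zero; suc; _+_; _*_; _≤_; _<_; _%_; _/_; NonZero; z≤n; s≤s; _≟_)
  open import Data.Nat.Properties
  open import Data.Nat.DivMod using (m≡m%n+[m/n]*n)
  open import Data.Nat.ListAction using (sum)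
  open import Data.Nat.Tactic.RingSolver using (solve-∀)
  open import Data.List using (List; []; _∷_; [_]; _++_; length; filter; map; concatMap; upTo)
  open import Data.Vec using (Vec) renaming ([] to []ᵛ; _∷_ to _∷ᵛ_)
  import Data.Vec.Relation.Unary.All as VecAll
  open import Data.List.Properties using (length-++; filter-++; filter-accept; filter-reject; filter-none; upTo-∷ʳ)
  open import Data.List.Membership.Propositional using (_∈_)
  open import Data.List.Relation.Unary.All as All using (All)
  open import Data.List.Relation.Unary.Any using (here; there)
  open import Data.Product using (∃; _×_; _,_)
  open import Data.Sum using (_⊎_; inj₁; inj₂)
  open import Relation.Nullary using (Dec; ¬_; yes; no; _×-dec_; ¬?; contradiction)
  open import Relation.Unary using (Pred; Decidable)
  open import Relation.Binary.PropositionalEquality using (_≡_; _≢_; refl; sym; trans; cong; cong₂; subst)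
  open import Function using (_∘_)

  count : ∀ {a p} {A : Set a} {P : Pred A p} → Decidable P → List A → ℕ
  count P? xs = length (filter P? xs)

  module _ {a b p} {A : Set a} {B : Set b} {P : Pred B p} (P? : Decidable P) where

    count-map : ∀ (f : A → B) xs → count P? (map f xs) ≡ count (λ x → P? (f x)) xs
    count-map f []       = refl
    count-map f (x ∷ xs) with P? (f x)
    ... | yes _ = cong suc (count-map f xs)
    ... | no  _ = count-map f xs

    count-concatMap : ∀ (f : A → List B) xs →
      count P? (concatMap f xs) ≡ sum (map (λ x → count P? (f x)) xs)
    count-concatMap f []       = refl
    count-concatMap f (x ∷ xs) = begin-equality
      length (filter P? (f x ++ concatMap f xs))              ≡⟨ cong length (filter-++ P? (f x) _) ⟩
      length (filter P? (f x) ++ filter P? (concatMap f xs))  ≡⟨ length-++ (filter P? (f x)) ⟩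
      count P? (f x) + count P? (concatMap f xs)              ≡⟨ cong (count P? (f x) +_) (count-concatMap f xs) ⟩
      count P? (f x) + sum (map (λ x → count P? (f x)) xs)    ∎
      where open ≤-Reasoning

  length-concatMap : ∀ {a b} {A : Set a} {B : Set b} {F : A → List B} {k} → (∀ x → length (F x) ≡ k) →
    ∀ xs → length (concatMap F xs) ≡ length xs * k
  length-concatMap |F|≡k []       = refl
  length-concatMap {F = F} |F|≡k (x ∷ xs) =
    trans (length-++ (F x)) (cong₂ _+_ (|F|≡k x) (length-concatMap |F|≡k xs))

  module _ {a p q r} {A : Set a} {P : Pred A p} {Q : Pred A q} {R : Pred A r}
           (P? : Decidable P) (Q? : Decidable Q) (R? : Decidable R) where

    count-⊆-∪ : (∀ {x} → P x → Q x ⊎ R x) → ∀ xs → count P? xs ≤ count Q? xs + count R? xs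
    count-⊆-∪ P⊆Q∪R []       = z≤n
    count-⊆-∪ P⊆Q∪R (x ∷ xs) with ih ← count-⊆-∪ P⊆Q∪R xs | P? x | Q? x | R? x
    ... | no  _  | yes _ | yes _ = ≤-trans (m≤n⇒m≤1+n ih) (+-monoʳ-≤ (suc (count Q? xs)) (n≤1+n _))
    ... | no  _  | yes _ | no  _ = m≤n⇒m≤1+n ih
    ... | no  _  | no  _ | yes _ = ≤-trans ih (+-monoʳ-≤ (count Q? xs) (n≤1+n _))
    ... | no  _  | no  _ | no  _ = ih
    ... | yes _  | yes _ | yes _ = s≤s (≤-trans ih (+-monoʳ-≤ (count Q? xs) (n≤1+n _)))
    ... | yes _  | yes _ | no  _ = s≤s ih
    ... | yes _  | no  _ | yes _ = ≤-trans (s≤s ih) (≤-reflexive (sym (+-suc _ _)))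
    ... | yes px | no ¬q | no ¬r with P⊆Q∪R px
    ...   | inj₁ qx = contradiction qx ¬q
    ...   | inj₂ rx = contradiction rx ¬r

  module _ {p} {P : Pred ℕ p} (P? : Decidable P) where

    private
      count-upTo-suc : ∀ N → count P? (upTo (suc N)) ≡ count P? (upTo N) + count P? [ N ]
      count-upTo-suc N = begin-equality
        count P? (upTo (suc N))                         ≡⟨ cong (count P?) (sym (upTo-∷ʳ N)) ⟩
        length (filter P? (upTo N ++ [ N ]))            ≡⟨ cong length (filter-++ P? (upTo N) [ N ]) ⟩
        length (filter P? (upTo N) ++ filter P? [ N ])  ≡⟨ length-++ (filter P? (upTo N)) ⟩
        count P? (upTo N) + count P? [ N ]              ∎
        where open ≤-Reasoning

      count-upTo-accept : ∀ {N} → P N → count P? (upTo (suc N)) ≡ count P? (upTo N) + 1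
      count-upTo-accept {N} pN = trans (count-upTo-suc N) (cong (λ xs → count P? (upTo N) + length xs) (filter-accept P? pN))

      count-upTo-reject : ∀ {N} → ¬ P N → count P? (upTo (suc N)) ≡ count P? (upTo N)
      count-upTo-reject {N} ¬pN = trans (count-upTo-suc N)
        (trans (cong (λ xs → count P? (upTo N) + length xs) (filter-reject P? ¬pN)) (+-identityʳ _))

    module _ {k : ℕ} (sparse : ∀ {x y} → P x → P y → x < y → x + k ≤ y) where

      private
        LastHit : ℕ → Set p
        LastHit N = count P? (upTo N) ≡ 0 ⊎ ∃ λ ℓ → ℓ < N × P ℓ × k * count P? (upTo N) ≤ ℓ + k

        lastHit : ∀ N → LastHit N
        lastHit zero = inj₁ refl
        lastHit (suc N) with lastHit N | P? N
        ... | inj₁ none | yes pN = inj₂ (N , ≤-refl , pN , (begin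
          k * count P? (upTo (suc N))   ≡⟨ cong (k *_) (trans (count-upTo-accept pN) (cong (_+ 1) none)) ⟩
          k * 1                         ≡⟨ *-identityʳ k ⟩
          k                             ≤⟨ m≤n+m k N ⟩
          N + k                         ∎))
          where open ≤-Reasoning
        ... | inj₂ (ℓ , ℓ<N , pℓ , bound) | yes pN = inj₂ (N , ≤-refl , pN , (begin
          k * count P? (upTo (suc N))   ≡⟨ cong (k *_) (count-upTo-accept pN) ⟩
          k * (count P? (upTo N) + 1)   ≡⟨ *-distribˡ-+ k _ 1 ⟩
          k * count P? (upTo N) + k * 1 ≤⟨ +-mono-≤ bound (≤-reflexive (*-identityʳ k)) ⟩
          ℓ + k + k                     ≤⟨ +-monoˡ-≤ k (sparse pℓ pN ℓ<N) ⟩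
          N + k                         ∎))
          where open ≤-Reasoning
        ... | inj₁ none | no ¬pN = inj₁ (trans (count-upTo-reject ¬pN) none)
        ... | inj₂ (ℓ , ℓ<N , pℓ , bound) | no ¬pN =
          inj₂ (ℓ , m<n⇒m<1+n ℓ<N , pℓ , subst (λ c → k * c ≤ ℓ + k) (sym (count-upTo-reject ¬pN)) bound)

      sparse-count : ∀ N → k * count P? (upTo N) ≤ N + k
      sparse-count N with lastHit N
      ... | inj₁ none = subst (λ c → k * c ≤ N + k) (sym none) (≤-trans (≤-reflexive (*-zeroʳ k)) z≤n)
      ... | inj₂ (ℓ , ℓ<N , _ , bound) = ≤-trans bound (+-monoˡ-≤ k (<⇒≤ ℓ<N))

  module _ (p : ℕ) .{{_ : NonZero p}} where

    %-sparse : ∀ {x y} → x % p ≡ y % p → x < y → x + p ≤ y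
    %-sparse {x} {y} eq x<y = begin
      x + p                      ≡⟨ cong (_+ p) (m≡m%n+[m/n]*n x p) ⟩
      x % p + x / p * p + p      ≡⟨ +-assoc (x % p) _ p ⟩
      x % p + (x / p * p + p)    ≡⟨ cong (x % p +_) (+-comm _ p) ⟩
      x % p + suc (x / p) * p    ≤⟨ +-mono-≤ (≤-reflexive eq) (*-monoˡ-≤ p quotient<) ⟩
      y % p + y / p * p          ≡⟨ sym (m≡m%n+[m/n]*n y p) ⟩
      y                          ∎
      where
      open ≤-Reasoning
      quotient< : x / p < y / p
      quotient< = ≰⇒> λ y/p≤x/p → <⇒≱ x<y (begin
        y                  ≡⟨ m≡m%n+[m/n]*n y p ⟩
        y % p + y / p * p  ≤⟨ +-mono-≤ (≤-reflexive (sym eq)) (*-monoˡ-≤ p y/p≤x/p) ⟩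
        x % p + x / p * p  ≡⟨ sym (m≡m%n+[m/n]*n x p) ⟩
        x                  ∎)

    count-residues : ∀ {q} {P : Pred ℕ q} (P? : Decidable P) L → (∀ {c} → P c → c % p ∈ L) →
      ∀ N → p * count P? (upTo N) ≤ length L * (N + p)
    count-residues {P = P} P? [] covered N =
      ≤-reflexive (trans (cong (λ xs → p * length xs) (filter-none P? nothingCounted)) (*-zeroʳ p))
      where
      nothingCounted : All (¬_ ∘ P) (upTo N)
      nothingCounted = All.universal (λ c pc → contradiction (covered pc) λ ()) (upTo N)
    count-residues {q} {P} P? (r ∷ L) covered N = begin
      p * count P? (upTo N)                       ≤⟨ *-monoʳ-≤ p (count-⊆-∪ P? inClass? Rest? split (upTo N)) ⟩
      p * (count inClass? (upTo N) + count Rest? (upTo N))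
                                                  ≡⟨ *-distribˡ-+ p _ _ ⟩
      p * count inClass? (upTo N) + p * count Rest? (upTo N)
                                                  ≤⟨ +-mono-≤ (sparse-count inClass? (λ x≡r y≡r → %-sparse (trans x≡r (sym y≡r))) N)
                                                              (count-residues Rest? L restCovered N) ⟩
      N + p + length L * (N + p)                  ∎
      where
      open ≤-Reasoning
      inClass? : ∀ c → Dec (c % p ≡ r)
      inClass? c = c % p ≟ r
      Rest : ℕ → Set q
      Rest c = P c × c % p ≢ r
      Rest? : Decidable Rest
      Rest? c = P? c ×-dec ¬? (inClass? c)
      split : ∀ {c} → P c → c % p ≡ r ⊎ Rest c
      split {c} pc with inClass? c
      ... | yes c≡r = inj₁ c≡r
      ... | no  c≢r = inj₂ (pc , c≢r)
      restCovered : ∀ {c} → Rest c → c % p ∈ L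
      restCovered (pc , c≢r) with covered pc
      ... | here c≡r = contradiction c≡r c≢r
      ... | there c∈L = c∈L

  module _ {a q} {A : Set a} {Q : Pred A q} (Q? : Decidable Q) (f : A → ℕ) {p K B : ℕ}
           (onQ : ∀ {v} → Q v → p * f v ≤ K) (offQ : ∀ {v} → ¬ Q v → p * f v ≤ B) where

    sum-bound-by-count : ∀ vs → p * sum (map f vs) ≤ K * count Q? vs + B * length vs
    sum-bound-by-count []       = ≤-reflexive (trans (*-zeroʳ p) (sym (cong₂ _+_ (*-zeroʳ K) (*-zeroʳ B))))
    sum-bound-by-count (v ∷ vs) with ih ← sum-bound-by-count vs | Q? v
    ... | yes qv = begin
      p * (f v + sum (map f vs))                        ≡⟨ *-distribˡ-+ p _ _ ⟩
      p * f v + p * sum (map f vs)                      ≤⟨ +-mono-≤ (onQ qv) ih ⟩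
      K + (K * count Q? vs + B * length vs)             ≤⟨ m≤m+n _ B ⟩
      K + (K * count Q? vs + B * length vs) + B         ≡⟨ rearrange K B (count Q? vs) (length vs) ⟩
      K * suc (count Q? vs) + B * suc (length vs)       ∎
      where
      open ≤-Reasoning
      rearrange : ∀ K B c l → K + (K * c + B * l) + B ≡ K * suc c + B * suc l
      rearrange = solve-∀
    ... | no ¬qv = begin
      p * (f v + sum (map f vs))                        ≡⟨ *-distribˡ-+ p _ _ ⟩
      p * f v + p * sum (map f vs)                      ≤⟨ +-mono-≤ (offQ ¬qv) ih ⟩
      B + (K * count Q? vs + B * length vs)             ≡⟨ rearrange K B (count Q? vs) (length vs) ⟩
      K * count Q? vs + B * suc (length vs)             ∎
      where
      open ≤-Reasoning
      rearrange : ∀ K B c l → B + (K * c + B * l) ≡ K * c + B * suc l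
      rearrange = solve-∀

  crossing : ∀ {q} {Q : Pred ℕ q} → Decidable Q → ¬ Q 0 → ∀ α → Q α → ∃ λ k → ¬ Q k × Q (suc k)
  crossing Q? ¬Q0 zero    Qα = contradiction Qα ¬Q0
  crossing Q? ¬Q0 (suc α) Qα with Q? α
  ... | yes Qα-1 = crossing Q? ¬Q0 α Qα-1
  ... | no ¬Qα-1 = α , ¬Qα-1 , Qα

  totalDeg≤⇒All≤ : ∀ {n d} (e : Vec ℕ n) → totalDeg e ≤ d → VecAll.All (_≤ d) e
  totalDeg≤⇒All≤ []ᵛ       _      = VecAll.[]
  totalDeg≤⇒All≤ (x ∷ᵛ e) |e|≤d =
    ≤-trans (m≤m+n x _) |e|≤d VecAll.∷ totalDeg≤⇒All≤ e (≤-trans (m≤n+m _ x) |e|≤d)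

module Polynomials {c ℓ} (R : CommutativeRing c ℓ) where

  open import Level using (Level; _⊔_)
  open import Algebra.Solver.Ring.AlmostCommutativeRing
    using (AlmostCommutativeRing; fromCommutativeRing; -raw-almostCommutative⟶)
  import Algebra.Solver.Ring as Solver
  open import Data.Fin using (Fin; toℕ; fromℕ<)
  open import Data.Fin.Properties using (any?; toℕ<n; toℕ-fromℕ<)
  open import Data.List using (List; []; _∷_; _++_; length; map; foldr; concatMap; upTo; applyUpTo)
  open import Data.List.Membership.Propositional using (_∈_)
  open import Data.List.Membership.Propositional.Properties using (∈-upTo⁺)
  open import Data.List.Properties using (map-∘; map-upTo; length-map; length-upTo)
  open import Data.List.Relation.Unary.All as All using (All; []; _∷_)
  import Data.List.Relation.Unary.All.Properties as All
  open import Data.List.Relation.Unary.Any using (here; there)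
  open import Data.Maybe using (nothing)
  open import Data.Nat as ℕ using (ℕ; zero; suc; _%_; _/_; NonZero; _<_)
  open import Data.Nat.Coprimality using (Coprime; coprime-Bézout; prime⇒coprime)
  open import Data.Nat.DivMod using (m≡m%n+[m/n]*n; m%n<n; m<n⇒m%n≡m)
  import Data.Nat.GCD as GCD
  open import Data.Nat.Primality using (Prime)
  import Data.Nat.Properties as ℕ
  open import Data.Product using (∃; _×_; _,_)
  open import Data.Sum using (_⊎_; inj₁; inj₂; [_,_]′)
  open import Data.Vec using (Vec; []; _∷_)
  open import Function using (_∘_)
  open import Relation.Binary.Definitions using (Decidable; tri<; tri≈; tri>)
  open import Relation.Binary.PropositionalEquality as ≡ using (_≡_; _≢_)
  open import Relation.Nullary using (¬_; yes; no; contradiction)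
  open Counting using (crossing)

  open CommutativeRing R
  open import Relation.Binary.Reasoning.Setoid setoid
  open import Algebra.Properties.Semiring.Mult semiring using (×-homo-+; ×1-homo-*) renaming (_×_ to _×ₙ_)
  open import Algebra.Properties.CommutativeSemigroup *-commutativeSemigroup using (x∙yz≈y∙xz; x∙yz≈xz∙y)
  open import Algebra.Properties.Group +-group using ()
    renaming (∙-cancelˡ to +-cancelˡ; ∙-cancelʳ to +-cancelʳ; identityʳ-unique to +-identityʳ-unique)

  private
    R′ : AlmostCommutativeRing c ℓ
    R′ = fromCommutativeRing R
  open Solver _ R′ (-raw-almostCommutative⟶ R′) (λ _ _ → nothing) using (solve; _:+_; _:*_; _:=_)

  ≉0⇒1≉0 : ∀ {x} → ¬ x ≈ 0# → ¬ 1# ≈ 0#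
  ≉0⇒1≉0 {x} x≉0 1≈0 = x≉0 (begin
    x        ≈⟨ *-identityʳ x ⟨
    x * 1#   ≈⟨ *-congˡ 1≈0 ⟩
    x * 0#   ≈⟨ zeroʳ x ⟩
    0#       ∎)

  fromℕ : ℕ → Carrier
  fromℕ = _·e R

  fromℕ≡×1 : ∀ k → fromℕ k ≡ k ×ₙ 1#
  fromℕ≡×1 zero    = ≡.refl
  fromℕ≡×1 (suc k) = ≡.cong (1# +_) (fromℕ≡×1 k)

  fromℕ-+ : ∀ a b → fromℕ (a ℕ.+ b) ≈ fromℕ a + fromℕ b
  fromℕ-+ a b = begin
    fromℕ (a ℕ.+ b)      ≡⟨ fromℕ≡×1 (a ℕ.+ b) ⟩
    (a ℕ.+ b) ×ₙ 1#      ≈⟨ ×-homo-+ 1# a b ⟩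
    a ×ₙ 1# + b ×ₙ 1#    ≡⟨ ≡.cong₂ _+_ (fromℕ≡×1 a) (fromℕ≡×1 b) ⟨
    fromℕ a + fromℕ b    ∎

  fromℕ-* : ∀ a b → fromℕ (a ℕ.* b) ≈ fromℕ a * fromℕ b
  fromℕ-* a b = begin
    fromℕ (a ℕ.* b)      ≡⟨ fromℕ≡×1 (a ℕ.* b) ⟩
    (a ℕ.* b) ×ₙ 1#      ≈⟨ ×1-homo-* a b ⟩
    a ×ₙ 1# * b ×ₙ 1#    ≡⟨ ≡.cong₂ _*_ (fromℕ≡×1 a) (fromℕ≡×1 b) ⟨
    fromℕ a * fromℕ b    ∎

  annihilator-*ˡ : ∀ k {a y} → fromℕ a * y ≈ 0# → fromℕ (k ℕ.* a) * y ≈ 0#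
  annihilator-*ˡ k {a} {y} ay≈0 = begin
    fromℕ (k ℕ.* a) * y        ≈⟨ *-congʳ (fromℕ-* k a) ⟩
    fromℕ k * fromℕ a * y      ≈⟨ *-assoc (fromℕ k) (fromℕ a) y ⟩
    fromℕ k * (fromℕ a * y)    ≈⟨ *-congˡ ay≈0 ⟩
    fromℕ k * 0#               ≈⟨ zeroʳ (fromℕ k) ⟩
    0#                         ∎

  annihilator-suc : ∀ {u y} → fromℕ u * y ≈ 0# → fromℕ (suc u) * y ≈ 0# → y ≈ 0#
  annihilator-suc {u} {y} uy≈0 suy≈0 = begin
    y                          ≈⟨ +-identityʳ y ⟨
    y + 0#                     ≈⟨ +-cong (*-identityˡ y) uy≈0 ⟨
    1# * y + fromℕ u * y       ≈⟨ distribʳ y 1# (fromℕ u) ⟨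
    fromℕ (suc u) * y          ≈⟨ suy≈0 ⟩
    0#                         ∎

  -- The k with fromℕ k * y ≈ 0# are closed under multiples, and Bézout yields two of them that differ by one.
  coprime-annihilators : ∀ {a b y} → Coprime a b → fromℕ a * y ≈ 0# → fromℕ b * y ≈ 0# → y ≈ 0#
  coprime-annihilators {a} {b} {y} a⊥b ay≈0 by≈0 with coprime-Bézout a⊥b
  ... | GCD.Bézout.+- i j 1+jb≡ia = annihilator-suc {j ℕ.* b} (annihilator-*ˡ j by≈0)
    (≡.subst (λ k → fromℕ k * y ≈ 0#) (≡.sym 1+jb≡ia) (annihilator-*ˡ i {a} ay≈0))
  ... | GCD.Bézout.-+ i j 1+ia≡jb = annihilator-suc {i ℕ.* a} (annihilator-*ˡ i ay≈0)
    (≡.subst (λ k → fromℕ k * y ≈ 0#) (≡.sym 1+ia≡jb) (annihilator-*ˡ j {b} by≈0))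

  fromℕ-∸-annihilates : ∀ {r s y} → r ℕ.≤ s → fromℕ r * y ≈ fromℕ s * y → fromℕ (s ℕ.∸ r) * y ≈ 0#
  fromℕ-∸-annihilates {r} {s} {y} r≤s ry≈sy = +-identityʳ-unique (fromℕ r * y) _ (begin
    fromℕ r * y + fromℕ (s ℕ.∸ r) * y       ≈⟨ distribʳ y _ _ ⟨
    (fromℕ r + fromℕ (s ℕ.∸ r)) * y         ≈⟨ *-congʳ (fromℕ-+ r (s ℕ.∸ r)) ⟨
    fromℕ (r ℕ.+ (s ℕ.∸ r)) * y             ≡⟨ ≡.cong (λ k → fromℕ k * y) (ℕ.m+[n∸m]≡n r≤s) ⟩
    fromℕ s * y                             ≈⟨ ry≈sy ⟨
    fromℕ r * y                             ∎)

  module _ {p} .{{_ : NonZero p}} {y} (py≈0 : fromℕ p * y ≈ 0#) where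

    fromℕ-%-* : ∀ c → fromℕ c * y ≈ fromℕ (c % p) * y
    fromℕ-%-* c = begin
      fromℕ c * y                                    ≡⟨ ≡.cong (λ k → fromℕ k * y) (m≡m%n+[m/n]*n c p) ⟩
      fromℕ (c % p ℕ.+ c / p ℕ.* p) * y              ≈⟨ *-congʳ (fromℕ-+ (c % p) _) ⟩
      (fromℕ (c % p) + fromℕ (c / p ℕ.* p)) * y      ≈⟨ distribʳ y _ _ ⟩
      fromℕ (c % p) * y + fromℕ (c / p ℕ.* p) * y    ≈⟨ +-congˡ (annihilator-*ˡ (c / p) py≈0) ⟩
      fromℕ (c % p) * y + 0#                         ≈⟨ +-identityʳ _ ⟩
      fromℕ (c % p) * y                              ∎

    module _ (prime : Prime p) where

      private
        distinct-below : ∀ {r s} → r < s → s < p → fromℕ r * y ≈ fromℕ s * y → y ≈ 0#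
        distinct-below {r} {s} r<s s<p ry≈sy = coprime-annihilators (prime⇒coprime prime δ<p) py≈0 δy≈0
          where
          δ : ℕ
          δ = s ℕ.∸ r
          instance
            δ≢0 : NonZero δ
            δ≢0 = ℕ.>-nonZero (ℕ.m<n⇒0<n∸m r<s)
          δ<p : δ < p
          δ<p = ℕ.≤-<-trans (ℕ.m∸n≤m s r) s<p
          δy≈0 : fromℕ δ * y ≈ 0#
          δy≈0 = fromℕ-∸-annihilates (ℕ.<⇒≤ r<s) ry≈sy

      fromℕ-*-injective-mod : ∀ c d → fromℕ c * y ≈ fromℕ d * y → c % p ≢ d % p → y ≈ 0#
      fromℕ-*-injective-mod c d cy≈dy c≢d with ℕ.<-cmp (c % p) (d % p)
      ... | tri< lt _ _ = distinct-below lt (m%n<n d p) (trans (sym (fromℕ-%-* c)) (trans cy≈dy (fromℕ-%-* d)))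
      ... | tri≈ _ eq _ = contradiction eq c≢d
      ... | tri> _ _ gt = distinct-below gt (m%n<n c p) (trans (sym (fromℕ-%-* d)) (trans (sym cy≈dy) (fromℕ-%-* c)))

  horner : List Carrier → Carrier → Carrier
  horner []      x = 0#
  horner (r ∷ t) x = r + x * horner t x

  quotientBy : Carrier → List Carrier → List Carrier
  quotientBy a []      = []
  quotientBy a (s ∷ u) = horner (s ∷ u) a ∷ quotientBy a u

  length-quotientBy : ∀ a t → length (quotientBy a t) ≡ length t
  length-quotientBy a []      = ≡.refl
  length-quotientBy a (s ∷ u) = ≡.cong suc (length-quotientBy a u)

  -- h(x) − h(a) = (x − a) q(x) for h = r ∷ t and q = quotientBy a t, with both sides moved so
  -- that no subtraction occurs.
  horner-factor : ∀ r t x a →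
    horner (r ∷ t) x + a * horner (quotientBy a t) x ≈ horner (r ∷ t) a + x * horner (quotientBy a t) x
  horner-factor r [] x a =
    solve 4 (λ r x a z → (r :+ x :* z) :+ a :* z := (r :+ a :* z) :+ x :* z) refl r x a 0#
  horner-factor r (s ∷ u) x a = begin
    (r + x * Tx) + a * (Ta + x * Q)   ≈⟨ solve 6 (λ r x a Tx Ta Q → (r :+ x :* Tx) :+ a :* (Ta :+ x :* Q)
                                                    := (r :+ a :* Ta) :+ x :* (Tx :+ a :* Q)) refl r x a Tx Ta Q ⟩
    (r + a * Ta) + x * (Tx + a * Q)   ≈⟨ +-congˡ (*-congˡ (horner-factor s u x a)) ⟩
    (r + a * Ta) + x * (Ta + x * Q)   ∎
    where
    Tx Ta Q : Carrier
    Tx = horner (s ∷ u) x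
    Ta = horner (s ∷ u) a
    Q  = horner (quotientBy a u) x

  _Annihilates_ : Carrier → List Carrier → Set (c ⊔ ℓ)
  t Annihilates h = All (λ r → t * r ≈ 0#) h

  IsZeroPoly : List Carrier → Set (c ⊔ ℓ)
  IsZeroPoly h = All (_≈ 0#) h

  horner-annihilated : ∀ {t} h x → t Annihilates h → t * horner h x ≈ 0#
  horner-annihilated []      x []          = zeroʳ _
  horner-annihilated {t} (r ∷ h) x (tr≈0 ∷ th≈0) = begin
    t * (r + x * horner h x)         ≈⟨ distribˡ t r _ ⟩
    t * r + t * (x * horner h x)     ≈⟨ +-cong tr≈0 (x∙yz≈y∙xz t x _) ⟩
    0# + x * (t * horner h x)        ≈⟨ +-identityˡ _ ⟩
    x * (t * horner h x)             ≈⟨ *-congˡ (horner-annihilated h x th≈0) ⟩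
    x * 0#                           ≈⟨ zeroʳ x ⟩
    0#                               ∎

  quotientBy-annihilated : ∀ {t} a u → t Annihilates u → t Annihilates quotientBy a u
  quotientBy-annihilated a []      []          = []
  quotientBy-annihilated a (s ∷ u) tsu@(_ ∷ tu) = horner-annihilated (s ∷ u) a tsu ∷ quotientBy-annihilated a u tu

  quotientBy-zero : ∀ {a} r t → horner (r ∷ t) a ≈ 0# → IsZeroPoly (quotientBy a t) → IsZeroPoly (r ∷ t)
  quotientBy-zero {a} r []      ha≈0 []              = trans (sym (trans (+-congˡ (zeroʳ a)) (+-identityʳ r))) ha≈0 ∷ []
  quotientBy-zero {a} r (s ∷ u) ha≈0 (hsu≈0 ∷ q≈0) = r≈0 ∷ quotientBy-zero s u hsu≈0 q≈0
    where
    r≈0 : r ≈ 0#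
    r≈0 = begin
      r                            ≈⟨ +-identityʳ r ⟨
      r + 0#                       ≈⟨ +-congˡ (zeroʳ a) ⟨
      r + a * 0#                   ≈⟨ +-congˡ (*-congˡ hsu≈0) ⟨
      r + a * horner (s ∷ u) a     ≈⟨ ha≈0 ⟩
      0#                           ∎

  horner-scale : ∀ s h x → horner (map (s *_) h) x ≈ s * horner h x
  horner-scale s []      x = sym (zeroʳ s)
  horner-scale s (r ∷ h) x = begin
    s * r + x * horner (map (s *_) h) x     ≈⟨ +-congˡ (*-congˡ (horner-scale s h x)) ⟩
    s * r + x * (s * horner h x)            ≈⟨ +-congˡ (x∙yz≈y∙xz x s _) ⟩
    s * r + s * (x * horner h x)            ≈⟨ distribˡ s r _ ⟨
    s * (r + x * horner h x)                ∎

  -- eval R d g as is definitionally ∑[ e ∈ allVecs n d ] (g e * monomial R e as).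
  ∑ : ∀ {a} {X : Set a} → List X → (X → Carrier) → Carrier
  ∑ xs f = foldr _+_ 0# (map f xs)

  syntax ∑ xs (λ x → e) = ∑[ x ∈ xs ] e

  private variable
    ℓˣ : Level
    X Y : Set ℓˣ

  ∑-cong : ∀ xs {f g : X → Carrier} → (∀ x → f x ≈ g x) → ∑ xs f ≈ ∑ xs g
  ∑-cong []       f≈g = refl
  ∑-cong (x ∷ xs) f≈g = +-cong (f≈g x) (∑-cong xs f≈g)

  ∑-zero : ∀ (xs : List X) → ∑[ x ∈ xs ] 0# ≈ 0#
  ∑-zero []       = refl
  ∑-zero (x ∷ xs) = trans (+-identityˡ _) (∑-zero xs)

  ∑-+ : ∀ xs (f g : X → Carrier) → ∑[ x ∈ xs ] (f x + g x) ≈ ∑ xs f + ∑ xs g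
  ∑-+ []       f g = sym (+-identityˡ 0#)
  ∑-+ (x ∷ xs) f g = trans (+-congˡ (∑-+ xs f g)) (+-assoc-swap (f x) (g x) (∑ xs f) (∑ xs g))
    where
    +-assoc-swap : ∀ a b c d → (a + b) + (c + d) ≈ (a + c) + (b + d)
    +-assoc-swap = solve 4 (λ a b c d → (a :+ b) :+ (c :+ d) := (a :+ c) :+ (b :+ d)) refl

  ∑-*ˡ : ∀ xs k (f : X → Carrier) → k * ∑ xs f ≈ ∑[ x ∈ xs ] (k * f x)
  ∑-*ˡ []       k f = zeroʳ k
  ∑-*ˡ (x ∷ xs) k f = trans (distribˡ k _ _) (+-congˡ (∑-*ˡ xs k f))

  ∑-*ʳ : ∀ xs k (f : X → Carrier) → ∑ xs f * k ≈ ∑[ x ∈ xs ] (f x * k)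
  ∑-*ʳ xs k f = trans (*-comm _ k) (trans (∑-*ˡ xs k f) (∑-cong xs (λ x → *-comm k (f x))))

  ∑-comm : ∀ xs (ys : List Y) (K : X → Y → Carrier) →
    ∑[ x ∈ xs ] ∑[ y ∈ ys ] K x y ≈ ∑[ y ∈ ys ] ∑[ x ∈ xs ] K x y
  ∑-comm []       ys K = sym (∑-zero ys)
  ∑-comm (x ∷ xs) ys K = begin
    ∑ ys (K x) + ∑[ x ∈ xs ] ∑ ys (K x)          ≈⟨ +-congˡ (∑-comm xs ys K) ⟩
    ∑ ys (K x) + ∑[ y ∈ ys ] ∑[ x ∈ xs ] K x y   ≈⟨ ∑-+ ys (K x) _ ⟨
    ∑[ y ∈ ys ] (K x y + ∑[ x ∈ xs ] K x y)      ∎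

  ∑-map : ∀ (h : X → Y) xs (f : Y → Carrier) → ∑ (map h xs) f ≡ ∑[ x ∈ xs ] f (h x)
  ∑-map h xs f = ≡.cong (foldr _+_ 0#) (≡.sym (map-∘ xs))

  ∑-++ : ∀ xs ys (f : X → Carrier) → ∑ (xs ++ ys) f ≈ ∑ xs f + ∑ ys f
  ∑-++ []       ys f = sym (+-identityˡ _)
  ∑-++ (x ∷ xs) ys f = trans (+-congˡ (∑-++ xs ys f)) (sym (+-assoc _ _ _))

  ∑-concatMap : ∀ (F : X → List Y) xs (f : Y → Carrier) →
    ∑ (concatMap F xs) f ≈ ∑[ x ∈ xs ] ∑ (F x) f
  ∑-concatMap F []       f = refl
  ∑-concatMap F (x ∷ xs) f = trans (∑-++ (F x) (concatMap F xs) f) (+-congˡ (∑-concatMap F xs f))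

  horner-upTo : ∀ k (F : ℕ → Carrier) a → horner (map F (upTo k)) a ≈ ∑[ j ∈ upTo k ] (F j * pow R a j)
  horner-upTo zero    F a = refl
  horner-upTo (suc k) F a = begin
    F 0 + a * horner (map F (applyUpTo suc k)) a        ≡⟨ ≡.cong (λ js → F 0 + a * horner (map F js) a) (map-upTo suc k) ⟨
    F 0 + a * horner (map F (map suc (upTo k))) a       ≡⟨ ≡.cong (λ cs → F 0 + a * horner cs a) (≡.sym (map-∘ (upTo k))) ⟩
    F 0 + a * horner (map (F ∘ suc) (upTo k)) a         ≈⟨ +-cong (sym (*-identityʳ (F 0))) (*-congˡ (horner-upTo k (F ∘ suc) a)) ⟩
    F 0 * 1# + a * ∑[ j ∈ upTo k ] (F (suc j) * pow R a j)
                                                        ≈⟨ +-congˡ (∑-*ˡ (upTo k) a _) ⟩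
    F 0 * 1# + ∑[ j ∈ upTo k ] (a * (F (suc j) * pow R a j))
                                                        ≈⟨ +-congˡ (∑-cong (upTo k) (λ j → x∙yz≈y∙xz a (F (suc j)) _)) ⟩
    F 0 * 1# + ∑[ j ∈ upTo k ] (F (suc j) * pow R a (suc j))
                                                        ≡⟨ ≡.cong (F 0 * 1# +_) (≡.sym (∑-map suc (upTo k) (λ j → F j * pow R a j))) ⟩
    F 0 * 1# + ∑[ j ∈ map suc (upTo k) ] (F j * pow R a j)
                                                        ≡⟨ ≡.cong (λ js → F 0 * 1# + ∑[ j ∈ js ] (F j * pow R a j)) (map-upTo suc k) ⟩
    F 0 * 1# + ∑[ j ∈ applyUpTo suc k ] (F j * pow R a j)
                                                        ∎

  eval-[] : ∀ d (g : Poly R 0) → eval R d g [] ≈ g []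
  eval-[] d g = trans (+-identityʳ _) (*-identityʳ _)

  headCoefficients : ∀ {n} → ℕ → Poly R (suc n) → Vec Carrier n → List Carrier
  headCoefficients d g as = map (λ j → eval R d (λ w → g (j ∷ w)) as) (upTo (suc d))

  length-headCoefficients : ∀ {n} d (g : Poly R (suc n)) as → length (headCoefficients d g as) ≡ suc d
  length-headCoefficients d g as = ≡.trans (length-map _ (upTo (suc d))) (length-upTo (suc d))

  headCoefficients-nonzero : ∀ {n d j} (g : Poly R (suc n)) as → j ℕ.≤ d →
    ¬ eval R d (λ w → g (j ∷ w)) as ≈ 0# → ¬ IsZeroPoly (headCoefficients d g as)
  headCoefficients-nonzero g as j≤d gⱼ≉0 coeffs≈0 = gⱼ≉0 (All.lookup (All.map⁻ coeffs≈0) (∈-upTo⁺ (ℕ.s≤s j≤d)))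

  eval-∷ : ∀ {n} d (g : Poly R (suc n)) a (as : Vec Carrier n) →
    eval R d g (a ∷ as) ≈ horner (headCoefficients d g as) a
  eval-∷ {n} d g a as = begin
    ∑ (concatMap (λ v → map (_∷ v) js) vs) T                  ≈⟨ ∑-concatMap (λ v → map (_∷ v) js) vs T ⟩
    ∑[ v ∈ vs ] ∑ (map (_∷ v) js) T                           ≈⟨ ∑-cong vs (λ v → reflexive (∑-map (_∷ v) js T)) ⟩
    ∑[ v ∈ vs ] ∑[ j ∈ js ] (g (j ∷ v) * (aʲ j * monomial R v as))
                                                              ≈⟨ ∑-comm js vs _ ⟨
    ∑[ j ∈ js ] ∑[ v ∈ vs ] (g (j ∷ v) * (aʲ j * monomial R v as))
                                                              ≈⟨ ∑-cong js (λ j → ∑-cong vs (λ v → x∙yz≈xz∙y _ (aʲ j) _)) ⟩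
    ∑[ j ∈ js ] ∑[ v ∈ vs ] (g (j ∷ v) * monomial R v as * aʲ j)
                                                              ≈⟨ ∑-cong js (λ j → ∑-*ʳ vs (aʲ j) _) ⟨
    ∑[ j ∈ js ] (eval R d (λ w → g (j ∷ w)) as * aʲ j)       ≈⟨ horner-upTo (suc d) _ a ⟨
    horner (map (λ j → eval R d (λ w → g (j ∷ w)) as) js) a   ∎
    where
    js : List ℕ
    js = upTo (suc d)
    vs : List (Vec ℕ n)
    vs = allVecs n d
    aʲ : ℕ → Carrier
    aʲ = pow R a
    T : Vec ℕ (suc n) → Carrier
    T e = g e * monomial R e (a ∷ as)

  RootResidues< : (p : ℕ) .{{_ : NonZero p}} → ℕ → List Carrier → Set ℓ
  RootResidues< p n h = ∃ λ (L : List ℕ) → length L < n × (∀ {k} → horner h (fromℕ k) ≈ 0# → k % p ∈ L)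

  module _ (_≟_ : Decidable _≈_) {p} (prime : Prime p) .{{_ : NonZero p}} where

    private
      quotient-annihilated : ∀ {r t} a x → fromℕ p Annihilates (r ∷ t) →
        fromℕ p * horner (quotientBy a t) x ≈ 0#
      quotient-annihilated {t = t} a x (_ ∷ ann) = horner-annihilated _ x (quotientBy-annihilated a t ann)

    horner-% : ∀ h c → fromℕ p Annihilates h → horner h (fromℕ c) ≈ horner h (fromℕ (c % p))
    horner-% []      c _   = refl
    horner-% (r ∷ t) c ann = +-cancelʳ (a * Q) _ _ (begin
      horner (r ∷ t) x + a * Q      ≈⟨ horner-factor r t x a ⟩
      horner (r ∷ t) a + x * Q      ≈⟨ +-congˡ (fromℕ-%-* (quotient-annihilated a x ann) c) ⟩
      horner (r ∷ t) a + a * Q      ∎)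
      where
      x a Q : Carrier
      x = fromℕ c
      a = fromℕ (c % p)
      Q = horner (quotientBy a t) x

    residue-root : ∀ h {c} → fromℕ p Annihilates h → horner h (fromℕ c) ≈ 0# →
      ∃ λ (i : Fin p) → horner h (fromℕ (toℕ i)) ≈ 0#
    residue-root h {c} ann hc≈0 = fromℕ< (m%n<n c p) , (begin
      horner h (fromℕ (toℕ (fromℕ< (m%n<n c p))))   ≡⟨ ≡.cong (horner h ∘ fromℕ) (toℕ-fromℕ< (m%n<n c p)) ⟩
      horner h (fromℕ (c % p))                      ≈⟨ horner-% h c ann ⟨
      horner h (fromℕ c)                            ≈⟨ hc≈0 ⟩
      0#                                            ∎)

    root-split : ∀ {r t i c} → i < p → fromℕ p Annihilates (r ∷ t) → horner (r ∷ t) (fromℕ i) ≈ 0# →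
      horner (r ∷ t) (fromℕ c) ≈ 0# → c % p ≡ i ⊎ horner (quotientBy (fromℕ i) t) (fromℕ c) ≈ 0#
    root-split {r} {t} {i} {c} i<p ann hi≈0 hc≈0 with c % p ℕ.≟ i
    ... | yes c≡i = inj₁ c≡i
    ... | no  c≢i = inj₂ (fromℕ-*-injective-mod (quotient-annihilated a x ann) prime c i xQ≈aQ
                            (λ c≡i → c≢i (≡.trans c≡i (m<n⇒m%n≡m i<p))))
      where
      x a Q : Carrier
      x = fromℕ c
      a = fromℕ i
      Q = horner (quotientBy a t) x
      xQ≈aQ : x * Q ≈ a * Q
      xQ≈aQ = +-cancelˡ 0# _ _ (begin
        0# + x * Q                    ≈⟨ +-congʳ hi≈0 ⟨
        horner (r ∷ t) a + x * Q      ≈⟨ horner-factor r t x a ⟨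
        horner (r ∷ t) x + a * Q      ≈⟨ +-congʳ hc≈0 ⟩
        0# + a * Q                    ∎)

    torsion-root-residues : ∀ n h → length h ≡ n → fromℕ p Annihilates h → ¬ IsZeroPoly h → RootResidues< p n h
    torsion-root-residues n       []      _   _   h≢0 = contradiction [] h≢0
    torsion-root-residues zero    (r ∷ t) ()  _   _
    torsion-root-residues (suc n) (r ∷ t) len ann h≢0
      with any? (λ (i : Fin p) → horner (r ∷ t) (fromℕ (toℕ i)) ≟ 0#)
    ... | no noRoot = [] , ℕ.s≤s ℕ.z≤n , λ {c} hc≈0 → contradiction (residue-root (r ∷ t) {c} ann hc≈0) noRoot
    ... | yes (i , hi≈0) with torsion-root-residues n (quotientBy (fromℕ (toℕ i)) t)
                                (≡.trans (length-quotientBy _ t) (ℕ.suc-injective len))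
                                (quotientBy-annihilated _ t (All.tail ann)) (h≢0 ∘ quotientBy-zero r t hi≈0)
    ...   | L , |L|<n , covered =
      toℕ i ∷ L , ℕ.s≤s |L|<n , λ hc≈0 → [ here , there ∘ covered ]′ (root-split (toℕ<n i) ann hi≈0 hc≈0)

    root-residues : ∀ α → fromℕ (p ℕ.^ α) ≈ 0# → ∀ h → ¬ IsZeroPoly h → RootResidues< p (length h) h
    root-residues α char h h≢0 with crossing (λ k → All.all? (λ r → (fromℕ (p ℕ.^ k) * r) ≟ 0#) h) ¬ann₀ α annα
      where
      ¬ann₀ : ¬ fromℕ 1 Annihilates h
      ¬ann₀ ann = h≢0 (All.map (λ {r} 1r≈0 → trans (sym (trans (*-congʳ (+-identityʳ 1#)) (*-identityˡ r))) 1r≈0) ann)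
      annα : fromℕ (p ℕ.^ α) Annihilates h
      annα = All.universal (λ r → trans (*-congʳ char) (zeroˡ r)) h
    ... | k , ¬ann-k , ann-k+1 with torsion-root-residues _ (map (s *_) h) ≡.refl p-ann s≢0
      where
      s : Carrier
      s = fromℕ (p ℕ.^ k)
      p-ann : fromℕ p Annihilates map (s *_) h
      p-ann = All.map⁺ (All.map (λ {r} pk+1r≈0 → trans (sym (*-assoc _ s r)) (trans (*-congʳ (sym (fromℕ-* p (p ℕ.^ k)))) pk+1r≈0)) ann-k+1)
      s≢0 : ¬ IsZeroPoly (map (s *_) h)
      s≢0 sh≈0 = ¬ann-k (All.map⁻ sh≈0)
    ... | L , |L|<|sh| , covered = L , ≡.subst (length L <_) (length-map _ h) |L|<|sh| , λ {c} hc≈0 → covered (begin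
      horner (map (s *_) h) (fromℕ c)   ≈⟨ horner-scale s h (fromℕ c) ⟩
      s * horner h (fromℕ c)            ≈⟨ *-congˡ hc≈0 ⟩
      s * 0#                            ≈⟨ zeroʳ s ⟩
      0#                                ∎)
      where
      s : Carrier
      s = fromℕ (p ℕ.^ k)

module ZeroCount {c ℓ} (R : CommutativeRing c ℓ) {m} (E : Encoding R m) where

  import Data.Bool.Properties as Bool
  open import Data.List using (List; length; upTo; map)
  open import Data.List.Properties using (length-map; length-upTo; length-filter; map-cong)
  open import Data.Nat using (ℕ; zero; suc; _+_; _*_; _^_; _≤_; NonZero)
  open import Data.Nat.ListAction using (sum)
  open import Data.Nat.Primality using (Prime; prime⇒nonZero)
  open import Data.Nat.Properties hiding (_≟_)
  open import Data.Nat.Tactic.RingSolver using (solve-∀)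
  open import Data.Product using (∃; _×_; _,_)
  open import Data.Vec as Vec using (Vec; []; _∷_)
  open import Data.Vec.Properties using (≡-dec)
  import Data.Vec.Relation.Unary.All as VecAll
  open import Function using (_∘_)
  open import Relation.Binary.Definitions using (Decidable)
  open import Relation.Binary.PropositionalEquality using (_≡_; refl; cong; subst)
    renaming (trans to ≡-trans)
  open import Relation.Nullary using (Dec; ¬_; yes; no; contradiction)
  open import Relation.Nullary.Decidable using (map′)
  open Counting
  open Polynomials R

  open CommutativeRing R using (Carrier; _≈_; 0#; sym; trans)
  open Encoding E

  _≟_ : Decidable _≈_
  x ≟ y = map′ enc-inj enc-sound (≡-dec Bool._≟_ (enc x) (enc y))

  NonZeroWithin : ∀ {n} → ℕ → Poly R n → Set ℓ
  NonZeroWithin d g = ∃ λ e → VecAll.All (_≤ d) e × ¬ g e ≈ 0#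

  NonZeroPoly⇒NonZeroWithin : ∀ {n d} (g : Poly R n) → DegreeAtMost R d g → NonZeroPoly R g → NonZeroWithin d g
  NonZeroPoly⇒NonZeroWithin g deg (e , g≉0) = e , totalDeg≤⇒All≤ e (≮⇒≥ (λ d<|e| → g≉0 (deg e d<|e|))) , g≉0

  length-allVecs : ∀ n M → length (allVecs n M) ≡ suc M ^ n
  length-allVecs zero    M = refl
  length-allVecs (suc n) M = ≡-trans
    (length-concatMap (λ v → ≡-trans (length-map (_∷ v) (upTo (suc M))) (length-upTo (suc M))) (allVecs n M))
    (≡-trans (cong (_* suc M) (length-allVecs n M)) (*-comm (suc M ^ n) (suc M)))

  module _ {p} (prime : Prime p) (α : ℕ) (char : fromℕ (p ^ α) ≈ 0#) (d M : ℕ) where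

    private instance
      p≢0 : NonZero p
      p≢0 = prime⇒nonZero prime

    ZeroAt : ∀ {n} → Poly R n → Vec ℕ n → Set
    ZeroAt g cs = enc (eval R d g (Vec.map fromℕ cs)) ≡ enc 0#

    zeroAt? : ∀ {n} (g : Poly R n) cs → Dec (ZeroAt g cs)
    zeroAt? g cs = isZero? R E (eval R d g (Vec.map fromℕ cs))

    fibre-count : ∀ {n} (g : Poly R (suc n)) {j} → j ≤ d → (v : Vec ℕ n) →
      ¬ eval R d (λ w → g (j ∷ w)) (Vec.map fromℕ v) ≈ 0# →
      p * count (λ c → zeroAt? g (c ∷ v)) (upTo (suc M)) ≤ d * (suc M + p)
    fibre-count {n} g {j} j≤d v gⱼ≉0 = count-bound (root-residues _≟_ prime α char H (headCoefficients-nonzero g as j≤d gⱼ≉0))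
      where
      as : Vec Carrier n
      as = Vec.map fromℕ v
      H : List Carrier
      H = headCoefficients d g as
      root : ∀ {c} → ZeroAt g (c ∷ v) → horner H (fromℕ c) ≈ 0#
      root {c} zero-at-c = trans (sym (eval-∷ d g (fromℕ c) as)) (enc-inj zero-at-c)
      count-bound : RootResidues< p (length H) H → p * count (λ c → zeroAt? g (c ∷ v)) (upTo (suc M)) ≤ d * (suc M + p)
      count-bound (L , |L|<|H| , covered) =
        ≤-trans (count-residues p (λ c → zeroAt? g (c ∷ v)) L (λ {c} → covered ∘ root {c}) (suc M))
                (*-monoˡ-≤ (suc M + p) (≤-pred (subst (suc (length L) ≤_) (length-headCoefficients d g as) |L|<|H|)))

    zeroCount-∷ : ∀ {n} (g : Poly R (suc n)) →
      zeroCount R E d g M ≡ sum (map (λ v → count (λ c → zeroAt? g (c ∷ v)) (upTo (suc M))) (allVecs n M))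
    zeroCount-∷ {n} g = ≡-trans (count-concatMap (zeroAt? g) (λ v → map (_∷ v) (upTo (suc M))) (allVecs n M))
      (cong sum (map-cong (λ v → count-map (zeroAt? g) (_∷ v) (upTo (suc M))) (allVecs n M)))

    zeroCount-bound : ∀ n (g : Poly R n) → NonZeroWithin d g →
      p * zeroCount R E d g M * suc M ≤ n * (d * (suc M + p)) * suc M ^ n
    zeroCount-bound zero g ([] , _ , g≉0) with zeroAt? g []
    ... | yes zero-at-[] = contradiction (trans (sym (eval-[] d g)) (enc-inj zero-at-[])) g≉0
    ... | no  _          = ≤-reflexive (cong (_* suc M) (*-zeroʳ p))
    zeroCount-bound (suc n) g (j ∷ e , j≤d VecAll.∷ e≤d , g≉0) = begin
      p * zeroCount R E d g M * suc M                     ≡⟨ cong (λ z → p * z * suc M) (zeroCount-∷ g) ⟩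
      p * sum (map fibre vs) * suc M                       ≤⟨ *-monoˡ-≤ (suc M) (sum-bound-by-count (zeroAt? gⱼ) fibre {p} onZero offZero vs) ⟩
      (p * suc M * Zⱼ + B * length vs) * suc M             ≡⟨ cong (λ l → (p * suc M * Zⱼ + B * l) * suc M) (length-allVecs n M) ⟩
      (p * suc M * Zⱼ + B * suc M ^ n) * suc M             ≡⟨ rearrangeˡ p (suc M) Zⱼ B (suc M ^ n) ⟩
      suc M * (p * Zⱼ * suc M) + B * suc M ^ n * suc M     ≤⟨ +-monoˡ-≤ _ (*-monoʳ-≤ (suc M) (zeroCount-bound n gⱼ (e , e≤d , g≉0))) ⟩
      suc M * (n * B * suc M ^ n) + B * suc M ^ n * suc M  ≡⟨ rearrangeʳ (suc M) n B (suc M ^ n) ⟩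
      suc n * B * (suc M * suc M ^ n)                      ∎
      where
      open ≤-Reasoning
      gⱼ : Poly R n
      gⱼ w = g (j ∷ w)
      B Zⱼ : ℕ
      B = d * (suc M + p)
      Zⱼ = zeroCount R E d gⱼ M
      vs : List (Vec ℕ n)
      vs = allVecs n M
      fibre : Vec ℕ n → ℕ
      fibre v = count (λ c → zeroAt? g (c ∷ v)) (upTo (suc M))
      onZero : ∀ {v} → ZeroAt gⱼ v → p * fibre v ≤ p * suc M
      onZero {v} _ = *-monoʳ-≤ p (≤-trans (length-filter (λ c → zeroAt? g (c ∷ v)) (upTo (suc M))) (≤-reflexive (length-upTo (suc M))))
      offZero : ∀ {v} → ¬ ZeroAt gⱼ v → p * fibre v ≤ B
      offZero {v} gⱼ≉0 = fibre-count g j≤d v (gⱼ≉0 ∘ enc-sound)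
      rearrangeˡ : ∀ p m z b k → (p * m * z + b * k) * m ≡ m * (p * z * m) + b * k * m
      rearrangeˡ = solve-∀
      rearrangeʳ : ∀ m n b k → m * (n * b * k) + b * k * m ≡ suc n * b * (m * k)
      rearrangeʳ = solve-∀

module Bits where

  open import Data.Bool using (Bool; false; true)
  open import Data.Fin using (Fin; zero; suc; combine)
  open import Data.Fin.Properties using (combine-injective)
  open import Data.Nat using (_^_)
  open import Data.Product using (_,_)
  open import Data.Vec using (Vec; []; _∷_)
  open import Function.Definitions using (Injective)
  open import Relation.Binary.PropositionalEquality using (_≡_; refl; cong₂)

  bit : Bool → Fin 2
  bit false = zero
  bit true  = suc zero

  bit-injective : Injective _≡_ _≡_ bit
  bit-injective {false} {false} _ = refl
  bit-injective {true}  {true}  _ = refl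
  bit-injective {false} {true}  ()
  bit-injective {true}  {false} ()

  bitsToFin : ∀ {m} → Vec Bool m → Fin (2 ^ m)
  bitsToFin []       = zero
  bitsToFin (b ∷ bs) = combine (bit b) (bitsToFin bs)

  bitsToFin-injective : ∀ {m} → Injective _≡_ _≡_ (bitsToFin {m})
  bitsToFin-injective {x = []}     {[]}     _  = refl
  bitsToFin-injective {x = b ∷ bs} {c ∷ cs} eq with combine-injective (bit b) (bitsToFin bs) (bit c) (bitsToFin cs) eq
  ... | b≡c , bs≡cs = cong₂ _∷_ (bit-injective b≡c) (bitsToFin-injective bs≡cs)

module Characteristic {c ℓ} (R : CommutativeRing c ℓ) {m} (E : Encoding R m) where

  open import Data.Fin using (Fin; toℕ)
  open import Data.Fin.Properties using (injective⇒≤; toℕ<n) renaming (<-cmp to <-cmpᶠ)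
  open import Data.Nat as ℕ using (_≤_; _^_; _∸_)
  open import Data.Nat.Properties using (m<n⇒0<n∸m; ≤-<-trans; ≤-trans; m∸n≤m; <⇒≤; m≤m*n; m^n≢0)
  open import Data.Nat.Primality using (Prime; prime⇒nonZero)
  open import Data.Product using (_,_)
  open import Function.Definitions using (Injective)
  open import Relation.Binary.Definitions using (tri<; tri≈; tri>)
  open import Relation.Binary.PropositionalEquality using (_≡_) renaming (sym to ≡-sym)
  open import Relation.Nullary using (¬_; contradiction)
  open CommutativeRing R
  open Encoding E
  open Polynomials R
  open Bits using (bitsToFin; bitsToFin-injective)

  characteristic≤2^m : ∀ {k} → HasCharacteristic R k → k ≤ 2 ^ m
  characteristic≤2^m {k} (_ , _ , minimal) = injective⇒≤ embed-injective
    where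
    embed : Fin k → Fin (2 ^ m)
    embed i = bitsToFin (enc (fromℕ (toℕ i)))
    distinct : ∀ {i j : Fin k} → toℕ i ℕ.< toℕ j → ¬ fromℕ (toℕ i) ≈ fromℕ (toℕ j)
    distinct {i} {j} i<j i≈j = minimal (toℕ j ∸ toℕ i) (m<n⇒0<n∸m i<j) (≤-<-trans (m∸n≤m (toℕ j) (toℕ i)) (toℕ<n j))
      (trans (sym (*-identityʳ _)) (fromℕ-∸-annihilates (<⇒≤ i<j) (*-congʳ i≈j)))
    embed-injective : Injective _≡_ _≡_ embed
    embed-injective {i} {j} eq with <-cmpᶠ i j
    ... | tri< i<j _ _ = contradiction (enc-inj (bitsToFin-injective eq)) (distinct i<j)
    ... | tri≈ _ i≡j _ = i≡j
    ... | tri> _ _ j<i = contradiction (enc-inj (bitsToFin-injective (≡-sym eq))) (distinct j<i)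

  prime≤2^m : ∀ {p} α → Prime p → HasCharacteristic R (p ^ α) → ¬ 1# ≈ 0# → p ≤ 2 ^ m
  prime≤2^m ℕ.zero      _       (_ , 1+0≈0 , _) 1≉0 = contradiction (trans (sym (+-identityʳ 1#)) 1+0≈0) 1≉0
  prime≤2^m {p} (ℕ.suc α) p-prime hasChar      _   =
    ≤-trans (m≤m*n p (p ^ α) {{m^n≢0 p α {{prime⇒nonZero p-prime}}}}) (characteristic≤2^m hasChar)

module Rationals where

  open import Data.Nat as ℕ using (ℕ; suc; _^_; NonZero)
  import Data.Nat.Properties as ℕ
  open import Data.Nat.Tactic.RingSolver using (solve-∀)
  open import Data.Integer as ℤ using (+_; +[1+_])
  import Data.Integer.Properties as ℤ
  open import Data.Rational as ℚ using (ℚ; mkℚ; _/_; _÷_; _≤_; _<_; _+_; 1ℚ; ½; Positive; toℚᵘ)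
  open import Data.Rational.Properties using (pos⇒nonZero; toℚᵘ-fromℚᵘ; toℚᵘ-mono-<; toℚᵘ-cancel-≤; toℚᵘ-homo-*; toℚᵘ-homo-+; toℚᵘ-homo-1/)
  open import Data.Rational.Unnormalised as ℚᵘ using (ℚᵘ; mkℚᵘ; _≃_; *≤*)
  import Data.Rational.Unnormalised.Properties as ℚᵘ
  open import Relation.Binary.PropositionalEquality using (_≡_; sym; trans; cong; cong₂; subst₂)

  toℚᵘ-/ : ∀ i n → toℚᵘ (i / suc n) ≃ mkℚᵘ i n
  toℚᵘ-/ i n = toℚᵘ-fromℚᵘ (mkℚᵘ i n)

  ÷-<-cross : ∀ x M (ε : ℚ) .{{_ : Positive ε}} → ((+ x / 1) ÷ ε) {{pos⇒nonZero ε}} < (+ M / 1) →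
    x ℕ.* ℚ.↧ₙ ε ℕ.< M ℕ.* ℤ.∣ ℚ.↥ ε ∣
  ÷-<-cross x M ε@(mkℚ +[1+ a ] b _) x÷ε<M = ℤ.drop‿+<+ (subst₂ ℤ._<_
      (trans (ℤ.*-identityʳ _) (sym (ℤ.pos-* x (suc b))))
      (trans (cong (+ M ℤ.*_) (ℤ.*-identityˡ +[1+ a ])) (sym (ℤ.pos-* M (suc a))))
      (ℚᵘ.drop-*<* (ℚᵘ.<-respʳ-≃ (toℚᵘ-/ (+ M) 0) (ℚᵘ.<-respˡ-≃ x÷ε≃ (toℚᵘ-mono-< x÷ε<M)))))
    where
    x÷ε≃ : toℚᵘ ((+ x / 1) ÷ ε) ≃ mkℚᵘ (+ x) 0 ℚᵘ.* mkℚᵘ +[1+ b ] a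
    x÷ε≃ = ℚᵘ.≃-trans (toℚᵘ-homo-* (+ x / 1) (ℚ.1/ ε)) (ℚᵘ.*-cong (toℚᵘ-/ (+ x) 0) (toℚᵘ-homo-1/ ε))

  -- Both sides are compared in ℚᵘ, where the numerator and denominator of rhs compute definitionally; the odd
  -- shapes such as p * (1 * (suc b * 2)) below are ↧ rhs and ↥ rhs as that computation leaves them.
  probability-bound : ∀ (Z N k p m M : ℕ) .{{_ : NonZero p}} .{{_ : NonZero N}} (ε : ℚ) .{{_ : Positive ε}} →
    ((+ (2 ^ suc m) / 1) ÷ ε) {{pos⇒nonZero ε}} < (+ M / 1) →
    p ℕ.* Z ℕ.* suc M ℕ.≤ k ℕ.* (suc M ℕ.+ p) ℕ.* N → p ℕ.≤ 2 ^ m →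
    (+ Z / N) ≤ (+ k / p) ℚ.* (1ℚ + ε ℚ.* ½)
  probability-bound Z N@(suc N′) k p@(suc p′) m M ε@(mkℚ +[1+ a ] b _) 2^m⁺¹/ε<M counted p≤2^m =
    toℚᵘ-cancel-≤ (ℚᵘ.≤-respʳ-≃ (ℚᵘ.≃-sym rhs≃) (ℚᵘ.≤-respˡ-≃ (ℚᵘ.≃-sym (toℚᵘ-/ (+ Z) N′)) (*≤* (subst₂ ℤ._≤_
      (ℤ.pos-* Z (p ℕ.* (1 ℕ.* (suc b ℕ.* 2))))
      (trans (ℤ.pos-* (k ℕ.* (suc b ℕ.* 2 ℕ.+ suc a)) N) (cong (ℤ._* + N) ↥rhs≡))
      (ℤ.+≤+ cross)))))
    where
    rhs : ℚᵘ
    rhs = mkℚᵘ (+ k) p′ ℚᵘ.* (mkℚᵘ (+ 1) 0 ℚᵘ.+ mkℚᵘ +[1+ a ] b ℚᵘ.* mkℚᵘ (+ 1) 1)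
    rhs≃ : toℚᵘ ((+ k / p) ℚ.* (1ℚ + ε ℚ.* ½)) ≃ rhs
    rhs≃ = ℚᵘ.≃-trans (toℚᵘ-homo-* (+ k / p) (1ℚ + ε ℚ.* ½))
             (ℚᵘ.*-cong (toℚᵘ-/ (+ k) p′) (ℚᵘ.≃-trans (toℚᵘ-homo-+ 1ℚ (ε ℚ.* ½))
               (ℚᵘ.+-cong ℚᵘ.≃-refl (toℚᵘ-homo-* ε ½))))
    ↥rhs≡ : + (k ℕ.* (suc b ℕ.* 2 ℕ.+ suc a)) ≡ ℚᵘ.↥ rhs
    ↥rhs≡ = trans (ℤ.pos-* k _) (cong (+ k ℤ.*_) (trans (ℤ.pos-+ (suc b ℕ.* 2) (suc a))
              (sym (cong₂ ℤ._+_ (ℤ.*-identityˡ (+ (suc b ℕ.* 2))) (trans (ℤ.*-identityʳ (+[1+ a ] ℤ.* ℤ.1ℤ)) (ℤ.*-identityʳ +[1+ a ]))))))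
    2p⁺b≤M⁺a : 2 ℕ.* p ℕ.* suc b ℕ.≤ suc M ℕ.* suc a
    2p⁺b≤M⁺a = begin
      2 ℕ.* p ℕ.* suc b        ≤⟨ ℕ.*-monoˡ-≤ (suc b) (ℕ.*-monoʳ-≤ 2 p≤2^m) ⟩
      2 ^ suc m ℕ.* suc b      ≤⟨ ℕ.<⇒≤ (÷-<-cross (2 ^ suc m) M ε 2^m⁺¹/ε<M) ⟩
      M ℕ.* suc a              ≤⟨ ℕ.*-monoˡ-≤ (suc a) (ℕ.n≤1+n M) ⟩
      suc M ℕ.* suc a          ∎
      where open ℕ.≤-Reasoning
    cross : Z ℕ.* (p ℕ.* (1 ℕ.* (suc b ℕ.* 2))) ℕ.≤ k ℕ.* (suc b ℕ.* 2 ℕ.+ suc a) ℕ.* N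
    cross = ℕ.*-cancelʳ-≤ _ _ (suc M) (begin
      Z ℕ.* (p ℕ.* (1 ℕ.* (suc b ℕ.* 2))) ℕ.* suc M              ≡⟨ rearrangeˡ Z p (suc b) (suc M) ⟩
      p ℕ.* Z ℕ.* suc M ℕ.* (suc b ℕ.* 2)                          ≤⟨ ℕ.*-monoˡ-≤ (suc b ℕ.* 2) counted ⟩
      k ℕ.* (suc M ℕ.+ p) ℕ.* N ℕ.* (suc b ℕ.* 2)                  ≡⟨ rearrange-mid k (suc M) p N (suc b) ⟩
      k ℕ.* N ℕ.* (suc M ℕ.* (suc b ℕ.* 2) ℕ.+ 2 ℕ.* p ℕ.* suc b)  ≤⟨ ℕ.*-monoʳ-≤ (k ℕ.* N) (ℕ.+-monoʳ-≤ (suc M ℕ.* (suc b ℕ.* 2)) 2p⁺b≤M⁺a) ⟩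
      k ℕ.* N ℕ.* (suc M ℕ.* (suc b ℕ.* 2) ℕ.+ suc M ℕ.* suc a)    ≡⟨ rearrangeʳ k (suc M) N (suc b) (suc a) ⟩
      k ℕ.* (suc b ℕ.* 2 ℕ.+ suc a) ℕ.* N ℕ.* suc M                ∎)
      where
      open ℕ.≤-Reasoning
      rearrangeˡ : ∀ z p b m → z ℕ.* (p ℕ.* (1 ℕ.* (b ℕ.* 2))) ℕ.* m ≡ p ℕ.* z ℕ.* m ℕ.* (b ℕ.* 2)
      rearrangeˡ = solve-∀
      rearrange-mid : ∀ k m p n b → k ℕ.* (m ℕ.+ p) ℕ.* n ℕ.* (b ℕ.* 2) ≡ k ℕ.* n ℕ.* (m ℕ.* (b ℕ.* 2) ℕ.+ 2 ℕ.* p ℕ.* b)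
      rearrange-mid = solve-∀
      rearrangeʳ : ∀ k m n b a → k ℕ.* n ℕ.* (m ℕ.* (b ℕ.* 2) ℕ.+ m ℕ.* a) ≡ k ℕ.* (b ℕ.* 2 ℕ.+ a) ℕ.* n ℕ.* m
      rearrangeʳ = solve-∀

open Rationals using (probability-bound)
import Data.Nat as ℕ
import Data.Nat.Properties as ℕ
open import Data.Product using (proj₁; proj₂)
open import Relation.Binary.PropositionalEquality using (cong; sym)

open import Algebra.Bundles using (CommutativeRing)
open import Data.Nat using (ℕ; suc; _^_; _*_)
open import Data.Nat.Primality using (Prime; prime⇒nonZero)
open import Data.Integer using (+_)
open import Data.Rational using (ℚ; _/_; _÷_; _≤_; _<_; _+_; 1ℚ; ½; Positive)
open import Data.Rational.Properties using (pos⇒nonZero)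

lemma3 : ∀ {c ℓ} (R : CommutativeRing c ℓ) (m : ℕ) (E : Encoding R m) → IsLocal R
    → (p α : ℕ) (pr : Prime p) → HasCharacteristic R (p ^ α)
    → (n d : ℕ) (g : Poly R n) → DegreeAtMost R d g
    → (ε : ℚ) {{ε>0 : Positive ε}} (M : ℕ)
    → ((+ (2 ^ suc m) / 1) ÷ ε) {{pos⇒nonZero ε}} < (+ M / 1)
    → NonZeroPoly R g
    → zeroProbability R E d g M ≤ ((+ (n * d) / p) {{prime⇒nonZero pr}} Data.Rational.* (1ℚ + ε Data.Rational.* ½))
lemma3 R m E _ p α pr hasChar n d g deg ε M ε-large g≢0 =
  probability-bound (zeroCount R E d g M) (suc M ^ n) (n * d) p m M {{prime⇒nonZero pr}} {{ℕ.m^n≢0 (suc M) n}}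
    ε ε-large counted (prime≤2^m α pr hasChar (≉0⇒1≉0 (proj₂ g≢0)))
  where
  open Polynomials R using (≉0⇒1≉0)
  open ZeroCount R E using (NonZeroPoly⇒NonZeroWithin; zeroCount-bound)
  open Characteristic R E using (prime≤2^m)
  counted : p * zeroCount R E d g M * suc M ℕ.≤ n * d * (suc M ℕ.+ p) * suc M ^ n
  counted = ℕ.≤-trans (zeroCount-bound pr α (proj₁ (proj₂ hasChar)) d M n g (NonZeroPoly⇒NonZeroWithin g deg g≢0))
                      (ℕ.≤-reflexive (cong (_* suc M ^ n) (sym (ℕ.*-assoc n d _))))
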